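{- Let $k \ge 1$ and let $G$ be a graph on $2k+1$ vertices. Let $\{V_1, V_2\}$ be a partition of $V(G)$ with $|V_1| = k+1$ and $|V_2| = k$ such that every vertex of $V_1$ is adjacent to every vertex of $V_2$. If there is an edge $e = \{x,y\}$ with $x, y \in V_1$, then $G$ is pancyclic.
   Context: A graph is pancyclic if it contains cycles of every length between $3$ and its number of vertices. -}

module Defs where

open import Level using (0ℓ)
open import Data.Nat using (ℕ; suc; _∸_; _≤_)
open import Data.Fin using (Fin; toℕ)
open import Data.Product using (Σ; _×_)
open import Relation.Binary.PropositionalEquality using (_≡_)
open import Relation.Nullary using (¬_)
open import Function.Definitions using (Injective)

record Graph (n : ℕ) : Set₁ where
  field
    Adj     : Fin n → Fin n → Set
    sym     : ∀ {u v} → Adj u v → Adj v u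
    irrefl  : ∀ {u} → ¬ Adj u u

open Graph public

record Cycle {n : ℕ} (G : Graph n) (ℓ : ℕ) : Set where
  field
    vertex   : Fin ℓ → Fin n
    distinct : Injective _≡_ _≡_ vertex
    step     : ∀ (i j : Fin ℓ) → toℕ j ≡ suc (toℕ i) → Adj G (vertex i) (vertex j)
    close    : ∀ (i j : Fin ℓ) → toℕ i ≡ ℓ ∸ 1 → toℕ j ≡ 0 → Adj G (vertex i) (vertex j)

Pancyclic : {n : ℕ} → Graph n → Set
Pancyclic {n} G = ∀ (ℓ : ℕ) → 3 ≤ ℓ → ℓ ≤ n → Cycle G ℓ

-- Enumerate V₂ as b₀, …, b_{k-1} and V₁ ∖ {x} as a₀ = y, a₁, …, a_{k-1}. For 1 ≤ m ≤ k the
-- sequence a₀ b₀ a₁ b₁ … a_{m-1} b_{m-1} is a path, since every step crosses the partition, and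
-- its last vertex lies in V₂, hence is adjacent to both a₀ and x. Closing it directly gives a
-- cycle of length 2m, closing it through x (using the edge x a₀ = xy) one of length 2m + 1;
-- these are all the lengths from 3 to 2k + 1.
module Submission where

open import Data.Nat using (ℕ; zero; suc; _+_; _*_; _≤_; _<_; ⌊_/2⌋; z≤n; s≤s; s≤s⁻¹)
open import Data.Nat.Properties
  using (+-suc; suc-injective; +-comm; +-identityʳ; +-mono-≤; ≤-trans; <-trans; n<1+n; n≤1+n;
         ≰⇒>; <⇒≱; ⌊n/2⌋-mono; n≡⌊n+n/2⌋; n≡⌈n+n/2⌉; module ≤-Reasoning)
open import Data.Fin using (Fin; zero; suc; toℕ)
open import Data.Fin.Properties using (toℕ-injective; toℕ<n)
open import Data.Fin.Subset
  using (Subset; inside; outside; _∈_; _∉_; _⊆_; _─_; _-_; ⁅_⁆; ∣_∣; ∁; Nonempty)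
open import Data.Fin.Subset.Properties
  using (p─⊥≡p; p─q⊆p; x∈p∧x≢y⇒x∈p-y; x∈⁅x⁆; x∈∁p⇒x∉p)
open import Data.Vec.Base using (_∷_; here; there)
open import Data.Product using (_,_; proj₂)
import Data.Product as Product
open import Function using (_∘_)
open import Relation.Binary.PropositionalEquality
  using (_≡_; _≢_; refl; sym; trans; cong; subst; subst₂; module ≡-Reasoning)
open import Relation.Nullary using (contradiction)
open import Defs renaming (sym to Adj-sym)

private
  variable
    n m : ℕ

q+q<m+m⇒q<m : ∀ {q m} → q + q < m + m → q < m
q+q<m+m⇒q<m h = ≰⇒> (λ m≤q → <⇒≱ h (+-mono-≤ m≤q m≤q))

2*k+1≡1+[k+k] : ∀ k → 2 * k + 1 ≡ suc (k + k)
2*k+1≡1+[k+k] k = trans (+-comm (2 * k) 1) (cong (λ t → suc (k + t)) (+-identityʳ k))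

m+m≤2k+1⇒m≤k : ∀ {m k} → m + m ≤ 2 * k + 1 → m ≤ k
m+m≤2k+1⇒m≤k {m} {k} h = begin
  m                  ≡⟨ n≡⌊n+n/2⌋ m ⟩
  ⌊ m + m /2⌋        ≤⟨ ⌊n/2⌋-mono (subst (m + m ≤_) (2*k+1≡1+[k+k] k) h) ⟩
  ⌊ suc (k + k) /2⌋  ≡⟨ sym (n≡⌈n+n/2⌉ k) ⟩
  k                  ∎
  where open ≤-Reasoning

data Half : ℕ → Set where
  even : ∀ q → Half (q + q)
  odd  : ∀ q → Half (suc (q + q))

half : ∀ i → Half i
half zero = even zero
half (suc i) with half i
... | even q = odd q
... | odd q  = subst Half (cong suc (+-suc q q)) (even (suc q))

x∈p─q⇒x∉q : ∀ {p q : Subset n} {x} → x ∈ p ─ q → x ∉ q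
x∈p─q⇒x∉q {p = _ ∷ _} {q = _ ∷ _} (there x∈p─q) (there x∈q) = x∈p─q⇒x∉q x∈p─q x∈q

x∈p-y⇒x≢y : ∀ {p : Subset n} {x y} → x ∈ p - y → x ≢ y
x∈p-y⇒x≢y x∈p-x refl = x∈p─q⇒x∉q x∈p-x (x∈⁅x⁆ _)

x∈p⇒1+∣p-x∣≡∣p∣ : ∀ {p : Subset n} {x} → x ∈ p → suc ∣ p - x ∣ ≡ ∣ p ∣
x∈p⇒1+∣p-x∣≡∣p∣ {p = inside ∷ p}  here        = cong (suc ∘ ∣_∣) (p─⊥≡p p)
x∈p⇒1+∣p-x∣≡∣p∣ {p = outside ∷ p} (there x∈p) = x∈p⇒1+∣p-x∣≡∣p∣ x∈p
x∈p⇒1+∣p-x∣≡∣p∣ {p = inside ∷ p}  (there x∈p) = cong suc (x∈p⇒1+∣p-x∣≡∣p∣ x∈p)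

∣p∣>0⇒Nonempty : ∀ {p : Subset n} → 0 < ∣ p ∣ → Nonempty p
∣p∣>0⇒Nonempty {p = inside ∷ p}  _ = zero , here
∣p∣>0⇒Nonempty {p = outside ∷ p} h = Product.map suc there (∣p∣>0⇒Nonempty h)

InjectiveBelow : ∀ {A : Set} → ℕ → (ℕ → A) → Set
InjectiveBelow m f = ∀ {i j} → i < m → j < m → f i ≡ f j → i ≡ j

prepend : ∀ {A : Set} → A → (ℕ → A) → ℕ → A
prepend x f zero    = x
prepend x f (suc i) = f i

prepend-injectiveBelow : ∀ {A : Set} {x : A} {f} →
  (∀ {i} → i < m → f i ≢ x) → InjectiveBelow m f → InjectiveBelow (suc m) (prepend x f)
prepend-injectiveBelow fresh inj {zero}  {zero}  _ _ _ = refl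
prepend-injectiveBelow fresh inj {zero}  {suc j} _ j<m eq = contradiction (sym eq) (fresh (s≤s⁻¹ j<m))
prepend-injectiveBelow fresh inj {suc i} {zero}  i<m _ eq = contradiction eq (fresh (s≤s⁻¹ i<m))
prepend-injectiveBelow fresh inj {suc i} {suc j} i<m j<m eq =
  cong suc (inj (s≤s⁻¹ i<m) (s≤s⁻¹ j<m) eq)

record DistinctSeq (p : Subset n) (m : ℕ) : Set where
  field
    seq           : ℕ → Fin n
    seq∈p         : ∀ {q} → q < m → seq q ∈ p
    seq-injective : InjectiveBelow m seq

open DistinctSeq

weaken : ∀ {p q : Subset n} → p ⊆ q → DistinctSeq p m → DistinctSeq q m
weaken p⊆q s = record { seq = seq s ; seq∈p = p⊆q ∘ seq∈p s ; seq-injective = seq-injective s }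

cons : ∀ {p : Subset n} {x} → x ∈ p → DistinctSeq (p - x) m → DistinctSeq p (suc m)
cons {p = p} {x} x∈p s = record
  { seq           = prepend x (seq s)
  ; seq∈p         = λ { {zero} _ → x∈p ; {suc q} q<m → p─q⊆p p ⁅ x ⁆ (seq∈p s (s≤s⁻¹ q<m)) }
  ; seq-injective = prepend-injectiveBelow (x∈p-y⇒x≢y ∘ seq∈p s) (seq-injective s)
  }

-- The first argument is an arbitrary filler value, used only for the empty sequence.
distinctSeq : ∀ {p : Subset n} → Fin n → m ≤ ∣ p ∣ → DistinctSeq p m

distinctSeqFrom : ∀ {p : Subset n} {x} → x ∈ p → suc m ≤ ∣ p ∣ → DistinctSeq p (suc m)
distinctSeqFrom {m = m} {x = x} x∈p 1+m≤∣p∣ =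
  cons x∈p (distinctSeq x (s≤s⁻¹ (subst (suc m ≤_) (sym (x∈p⇒1+∣p-x∣≡∣p∣ x∈p)) 1+m≤∣p∣)))

distinctSeq {m = zero}  d _ = record { seq = λ _ → d ; seq∈p = λ () ; seq-injective = λ () }
distinctSeq {m = suc m} _ 1+m≤∣p∣ =
  distinctSeqFrom (proj₂ (∣p∣>0⇒Nonempty (≤-trans (s≤s z≤n) 1+m≤∣p∣))) 1+m≤∣p∣

alternate : ∀ {A : Set} → (ℕ → A) → (ℕ → A) → ℕ → A
alternate a b zero          = a zero
alternate a b (suc zero)    = b zero
alternate a b (suc (suc i)) = alternate (a ∘ suc) (b ∘ suc) i

alternate-even : ∀ {A : Set} (a b : ℕ → A) q → alternate a b (q + q) ≡ a q
alternate-even a b zero    = refl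
alternate-even a b (suc q) = begin
  alternate a b (suc (q + suc q))        ≡⟨ cong (λ t → alternate a b (suc t)) (+-suc q q) ⟩
  alternate (a ∘ suc) (b ∘ suc) (q + q)  ≡⟨ alternate-even (a ∘ suc) (b ∘ suc) q ⟩
  a (suc q)                              ∎
  where open ≡-Reasoning

alternate-odd : ∀ {A : Set} (a b : ℕ → A) q → alternate a b (suc (q + q)) ≡ b q
alternate-odd a b zero    = refl
alternate-odd a b (suc q) = begin
  alternate a b (suc (suc (q + suc q)))        ≡⟨ cong (λ t → alternate a b (suc (suc t))) (+-suc q q) ⟩
  alternate (a ∘ suc) (b ∘ suc) (suc (q + q))  ≡⟨ alternate-odd (a ∘ suc) (b ∘ suc) q ⟩
  b (suc q)                                    ∎
  where open ≡-Reasoning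

module _ (G : Graph n) where

  cycle : ∀ {ℓ} (f : ℕ → Fin n) → InjectiveBelow (suc ℓ) f →
          (∀ {i} → suc i < suc ℓ → Adj G (f i) (f (suc i))) → Adj G (f ℓ) (f 0) →
          Cycle G (suc ℓ)
  cycle {ℓ} f inj step close = record
    { vertex   = f ∘ toℕ
    ; distinct = λ {i} {j} → toℕ-injective ∘ inj (toℕ<n i) (toℕ<n j)
    ; step     = λ i j j≡1+i →
        subst (Adj G (f (toℕ i)) ∘ f) (sym j≡1+i) (step (subst (_< suc ℓ) j≡1+i (toℕ<n j)))
    ; close    = λ i j i≡ℓ j≡0 → subst₂ (λ s t → Adj G (f s) (f t)) (sym i≡ℓ) (sym j≡0) close
    }

module Bipartite (G : Graph n) (S : Subset n) (cross : ∀ u v → u ∈ S → v ∉ S → Adj G u v)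
                 {m} (a : DistinctSeq S (suc m)) (b : DistinctSeq (∁ S) (suc m)) where

  path : ℕ → Fin n
  path = alternate (seq a) (seq b)

  path-even : ∀ q → path (q + q) ≡ seq a q
  path-even = alternate-even (seq a) (seq b)

  path-odd : ∀ q → path (suc (q + q)) ≡ seq b q
  path-odd = alternate-odd (seq a) (seq b)

  path-last : path (m + suc m) ≡ seq b m
  path-last = trans (cong path (+-suc m m)) (path-odd m)

  even< : ∀ {q} → q + q < suc m + suc m → q < suc m
  even< = q+q<m+m⇒q<m

  odd< : ∀ {q} → suc (q + q) < suc m + suc m → q < suc m
  odd< = q+q<m+m⇒q<m ∘ <-trans (n<1+n _)

  next< : ∀ {q} → suc (suc (q + q)) < suc m + suc m → suc q < suc m
  next< {q} = even< ∘ subst (_< suc m + suc m) (cong suc (sym (+-suc q q)))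

  b∉S : ∀ {r} → r < suc m → seq b r ∉ S
  b∉S = x∈∁p⇒x∉p ∘ seq∈p b

  a~b : ∀ {q r} → q < suc m → r < suc m → Adj G (seq a q) (seq b r)
  a~b q<m r<m = cross _ _ (seq∈p a q<m) (b∉S r<m)

  a≢b : ∀ {q r} → q < suc m → r < suc m → seq a q ≢ seq b r
  a≢b q<m r<m a≡b = b∉S r<m (subst (_∈ S) a≡b (seq∈p a q<m))

  path-injective : InjectiveBelow (suc m + suc m) path
  path-injective {i} {j} i<2m j<2m eq with half i | half j
  ... | even q | even r = cong (λ t → t + t) (seq-injective a (even< i<2m) (even< j<2m)
                            (trans (sym (path-even q)) (trans eq (path-even r))))
  ... | even q | odd r  = contradiction (trans (sym (path-even q)) (trans eq (path-odd r)))
                            (a≢b (even< i<2m) (odd< j<2m))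
  ... | odd q  | even r = contradiction (trans (sym (path-even r)) (trans (sym eq) (path-odd q)))
                            (a≢b (even< j<2m) (odd< i<2m))
  ... | odd q  | odd r  = cong (λ t → suc (t + t)) (seq-injective b (odd< i<2m) (odd< j<2m)
                            (trans (sym (path-odd q)) (trans eq (path-odd r))))

  path-step : ∀ {i} → suc i < suc m + suc m → Adj G (path i) (path (suc i))
  path-step {i} 1+i<2m with half i
  ... | even q = subst₂ (Adj G) (sym (path-even q)) (sym (path-odd q))
                   (a~b (odd< 1+i<2m) (odd< 1+i<2m))
  ... | odd q  = subst₂ (Adj G) (sym (path-odd q))
                   (sym (alternate-even (seq a ∘ suc) (seq b ∘ suc) q))
                   (Adj-sym G (a~b (next< 1+i<2m) (odd< (<-trans (n<1+n _) 1+i<2m))))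

  evenCycle : Cycle G (suc m + suc m)
  evenCycle = cycle G path path-injective path-step
    (Adj-sym G (subst (Adj G (seq a 0)) (sym path-last) (a~b (s≤s z≤n) (n<1+n m))))

  oddCycle : ∀ {x} → x ∈ S → (∀ {q} → q < suc m → seq a q ≢ x) → Adj G x (seq a 0) →
             Cycle G (suc (suc m + suc m))
  oddCycle {x} x∈S a≢x x~a₀ =
    cycle G (prepend x path) (prepend-injectiveBelow path≢x path-injective)
    (λ { {zero} _ → x~a₀ ; {suc i} 2+i<2m+1 → path-step (s≤s⁻¹ 2+i<2m+1) })
    (Adj-sym G (subst (Adj G x) (sym path-last) (cross x _ x∈S (b∉S (n<1+n m)))))
    where
    path≢x : ∀ {i} → i < suc m + suc m → path i ≢ x
    path≢x {i} i<2m with half i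
    ... | even q = a≢x (even< i<2m) ∘ trans (sym (path-even q))
    ... | odd q  = λ path≡x →
      b∉S (odd< i<2m) (subst (_∈ S) (trans (sym path≡x) (path-odd q)) x∈S)

lemma11 : (k : ℕ) → 1 ≤ k → (G : Graph (2 * k + 1)) → (S : Subset (2 * k + 1))
    → ∣ S ∣ ≡ suc k → ∣ ∁ S ∣ ≡ k
    → (∀ (u v : Fin (2 * k + 1)) → u ∈ S → v ∉ S → Adj G u v)
    → (x y : Fin (2 * k + 1)) → x ∈ S → y ∈ S → Adj G x y
    → Pancyclic G
lemma11 k _ G S ∣S∣≡1+k ∣∁S∣≡k cross x y x∈S y∈S x~y ℓ 3≤ℓ ℓ≤2k+1 =
  cycleOfLength (half ℓ) 3≤ℓ ℓ≤2k+1
  where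
  y∈S-x : y ∈ S - x
  y∈S-x = x∈p∧x≢y⇒x∈p-y y∈S (λ { refl → irrefl G x~y })

  ∣S-x∣≡k : ∣ S - x ∣ ≡ k
  ∣S-x∣≡k = suc-injective (trans (x∈p⇒1+∣p-x∣≡∣p∣ x∈S) ∣S∣≡1+k)

  a : ∀ {m} → suc m ≤ k → DistinctSeq (S - x) (suc m)
  a 1+m≤k = distinctSeqFrom y∈S-x (subst (_ ≤_) (sym ∣S-x∣≡k) 1+m≤k)

  b : ∀ {m} → suc m ≤ k → DistinctSeq (∁ S) (suc m)
  b 1+m≤k = distinctSeq x (subst (_ ≤_) (sym ∣∁S∣≡k) 1+m≤k)

  module Cycles {m} (1+m≤k : suc m ≤ k) =
    Bipartite G S cross (weaken (p─q⊆p S ⁅ x ⁆) (a 1+m≤k)) (b 1+m≤k)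

  cycleOfLength : ∀ {ℓ} → Half ℓ → 3 ≤ ℓ → ℓ ≤ 2 * k + 1 → Cycle G ℓ
  cycleOfLength (even zero)    ()
  cycleOfLength (odd zero)     (s≤s ())
  cycleOfLength (even (suc m)) _ 2m≤2k+1 = Cycles.evenCycle (m+m≤2k+1⇒m≤k 2m≤2k+1)
  cycleOfLength (odd (suc m))  _ 2m+1≤2k+1 =
    Cycles.oddCycle 1+m≤k x∈S (x∈p-y⇒x≢y ∘ seq∈p (a 1+m≤k)) x~y
    where
    1+m≤k : suc m ≤ k
    1+m≤k = m+m≤2k+1⇒m≤k (≤-trans (n≤1+n _) 2m+1≤2k+1)
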